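{- There is an absolute constant $c>0$ such that the following holds. Let $d \ge 1$, let $\epsilon\in(0,1]$, and let $\mathcal P$ be a set of $n$ points and $\mathcal H$ a set of $m$ hyperplanes in $\mathbb R^d$ such that $\operatorname{I}(\mathcal P,\mathcal H) \ge \epsilon\, mn$. If $\frac{\epsilon^d}{2} n > 1$, then \[ \operatorname{rs}(\mathcal P,\mathcal H) \ \ge\ c\cdot \frac{\epsilon^{2d}}{d}\, mn. \]
   Context: A hyperplane in $\mathbb R^d$ is a set $\{x : \langle a,x\rangle = b\}$ with $a\ne 0$. A point $p$ and hyperplane $h$ are incident if $p\in h$. For finite sets $\mathcal P$ of points and $\mathcal H$ of hyperplanes, $\operatorname{I}(\mathcal P,\mathcal H)$ is the number of incident pairs $(p,h)\in\mathcal P\times\mathcal H$, and $\operatorname{rs}(\mathcal P,\mathcal H)$ is the maximum number of edges of a complete bipartite subgraph of the bipartite incidence graph between $\mathcal P$ and $\mathcal H$; equivalently, $\operatorname{rs}(\mathcal P,\mathcal H)=\max_S |\{p\in\mathcal P: p\in S\}|\cdot|\{h\in\mathcal H: S\subseteq h\}|$, the maximum over all affine subspaces $S\subseteq\mathbb R^d$. -}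

module Defs where

open import Level using (0ℓ)
open import Data.Nat as ℕ using (ℕ; zero; suc)
open import Data.Fin using (Fin)
open import Data.Vec using (Vec; []; _∷_)
open import Data.Vec.Relation.Unary.All as VAll using ()
open import Data.List using (List; length)
open import Data.List.Relation.Unary.All as LAll using ()
open import Data.List.Relation.Unary.Unique.Propositional using (Unique)
open import Data.Product using (Σ; ∃; _×_; _,_)
open import Relation.Binary.PropositionalEquality using (_≡_; _≢_)
open import Relation.Binary.Core using (Rel)
open import Relation.Binary.Structures using (IsTotalOrder)
open import Relation.Nullary using (¬_)
open import Algebra.Core using (Op₁; Op₂)
open import Algebra.Structures using (IsCommutativeRing)

-- A Dedekind-complete ordered field (axiomatic real numbers); every such
-- field is isomorphic to ℝ, so quantifying over all of them is stating the
-- result for ℝ.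
record CompleteOrderedField : Set₁ where
  infixl 6 _+_
  infixl 7 _*_
  infix 4 _≤_
  field
    Carrier : Set
    _+_ _*_ : Op₂ Carrier
    -_ : Op₁ Carrier
    0# 1# : Carrier
    isCommutativeRing : IsCommutativeRing _≡_ _+_ _*_ -_ 0# 1#
    0≢1 : 0# ≢ 1#
    inverse : ∀ x → x ≢ 0# → ∃ λ y → x * y ≡ 1#
    _≤_ : Rel Carrier 0ℓ
    ≤-isTotalOrder : IsTotalOrder _≡_ _≤_
    +-monoˡ-≤ : ∀ {x y} z → x ≤ y → x + z ≤ y + z
    *-nonneg : ∀ {x y} → 0# ≤ x → 0# ≤ y → 0# ≤ x * y
    lub : (S : Carrier → Set) → ∃ S → (∃ λ b → ∀ x → S x → x ≤ b) →
          ∃ λ s → (∀ x → S x → x ≤ s) × (∀ b → (∀ x → S x → x ≤ b) → s ≤ b)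

  infix 4 _<_
  _<_ : Rel Carrier 0ℓ
  x < y = x ≤ y × x ≢ y

  fromℕ : ℕ → Carrier
  fromℕ zero = 0#
  fromℕ (suc k) = 1# + fromℕ k

  infixr 8 _^_
  _^_ : Carrier → ℕ → Carrier
  x ^ zero = 1#
  x ^ suc k = x * x ^ k

  Point : ℕ → Set
  Point d = Vec Carrier d

  dot : ∀ {d} → Vec Carrier d → Vec Carrier d → Carrier
  dot [] [] = 0#
  dot (a ∷ as) (x ∷ xs) = a * x + dot as xs

  record Hyperplane (d : ℕ) : Set where
    field
      normal : Vec Carrier d
      offset : Carrier
      normal≢0 : ¬ VAll.All (_≡ 0#) normal

  Incident : ∀ {d} → Point d → Hyperplane d → Set
  Incident p h = dot (Hyperplane.normal h) p ≡ Hyperplane.offset h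

  SameHyperplane : ∀ {d} → Hyperplane d → Hyperplane d → Set
  SameHyperplane h h' = ∀ x → (Incident x h → Incident x h') × (Incident x h' → Incident x h)

  -- 𝒫 = {P i : i < n} a set of n points (P injective),
  -- ℋ = {H j : j < m} a set of m hyperplanes (pairwise distinct as point sets)
  DistinctPoints : ∀ {d n} → (Fin n → Point d) → Set
  DistinctPoints P = ∀ i j → P i ≡ P j → i ≡ j

  DistinctHyperplanes : ∀ {d m} → (Fin m → Hyperplane d) → Set
  DistinctHyperplanes H = ∀ i j → SameHyperplane (H i) (H j) → i ≡ j

  -- I(𝒫,ℋ) ≥ t : there are at least t (as a field element) distinct incident pairs
  IncidencesAtLeast : ∀ {d n m} → (Fin n → Point d) → (Fin m → Hyperplane d) → Carrier → Set
  IncidencesAtLeast {n = n} {m} P H t =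
    Σ (List (Fin n × Fin m)) λ L →
      Unique L × LAll.All (λ { (i , j) → Incident (P i) (H j) }) L × t ≤ fromℕ (length L)

  -- rs(𝒫,ℋ) = max #edges of a complete bipartite subgraph of the incidence graph:
  -- a complete bipartite subgraph with point side A and hyperplane side B
  CompleteBipartite : ∀ {d n m} → (Fin n → Point d) → (Fin m → Hyperplane d) →
                      List (Fin n) → List (Fin m) → Set
  CompleteBipartite P H A B =
    Unique A × Unique B × LAll.All (λ i → LAll.All (λ j → Incident (P i) (H j)) B) A

-- Let deg h be the number of points on h. By the power-mean inequality I^(d+1) ≤ m^d Σ_h deg(h)^(d+1),
-- and the sum counts the pairs (T, h) of a (d+1)-tuple T of points and a hyperplane h through all of T.
-- Build T one point at a time. If some point already lies on every hyperplane through the earlier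
-- points, charge it the number of those hyperplanes; otherwise the lifted points (1, p) of T are
-- linearly independent in F^(d+1), so no hyperplane passes through all d+1 of them. Hence the pairs
-- are dominated by the total charge, and averaging the charge over all tuples produces a tuple T′
-- with I^(d+1) ≤ (mn)^d (d+1) |A||B|, where B is the set of hyperplanes through T′ and A the set of
-- points on all of them; A × B is complete bipartite, and ε^(d+1) mn ≤ (d+1)|A||B| ≤ 2d|A||B|.
module Submission where

open import Defs
open import Data.Nat using (ℕ)
open import Data.Nat as N using ()
open import Data.Fin as Fin using (Fin)
open import Data.List using (List; length)
open import Data.Product using (Σ; ∃; _×_; _,_; proj₁; proj₂)

open import Algebra.Bundles using (CommutativeRing)
open import Algebra.Structures using (IsCommutativeRing)
import Algebra.Properties.Ring as RingProperties
import Algebra.Solver.Ring.NaturalCoefficients.Default as FieldSolver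
import Data.Nat.Properties as ℕₚ
open import Function using (_∘_)
open import Data.Empty using (⊥-elim)
open import Data.Sum as Sum using (_⊎_; inj₁; inj₂; [_,_]′)
open import Data.Unit using (⊤)
open import Data.Vec using (Vec; []; _∷_; tail; zipWith; map)
import Data.Vec.Relation.Unary.All as VAll
open import Data.List as List using ([]; _∷_)
import Data.List.Properties as ListP
open import Data.List.Relation.Unary.All as All using (All; []; _∷_)
open import Relation.Binary.PropositionalEquality
open import Relation.Binary.Structures using (IsTotalOrder)
open import Relation.Binary.Bundles using (Poset)
import Relation.Binary.Reasoning.PartialOrder as PosetReasoning
open import Relation.Nullary using (¬_; Dec; yes; no)
open import Relation.Binary.Definitions using (DecidableEquality)

module OrderedFieldProperties (F : CompleteOrderedField) where
  open CompleteOrderedField F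
  open IsCommutativeRing isCommutativeRing public
    using ( +-identityˡ; +-identityʳ; *-identityˡ; *-identityʳ; -‿inverseˡ; -‿inverseʳ
          ; zeroˡ; zeroʳ; +-comm; *-comm; +-assoc; *-assoc; distribʳ)
  open IsTotalOrder ≤-isTotalOrder public
    using (total; antisym) renaming (refl to ≤-refl; trans to ≤-trans; reflexive to ≤-reflexive)

  commutativeRing : CommutativeRing _ _
  commutativeRing = record { isCommutativeRing = isCommutativeRing }

  open RingProperties (CommutativeRing.ring commutativeRing) public
    using ( -‿distribˡ-*; -‿distribʳ-*; -‿involutive; -0#≈0#; +-inverseʳ-unique
          ; x∙y⁻¹≈ε⇒x≈y; x≈y⇒x∙y⁻¹≈ε)
  open FieldSolver (CommutativeRing.commutativeSemiring commutativeRing) public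
    using (solve; _:=_; _:+_; _:*_)

  ≤-poset : Poset _ _ _
  ≤-poset = record { isPartialOrder = IsTotalOrder.isPartialOrder ≤-isTotalOrder }

  module ≤-Reasoning = PosetReasoning ≤-poset

  +-monoʳ-≤ : ∀ {x y} z → x ≤ y → z + x ≤ z + y
  +-monoʳ-≤ {x} {y} z x≤y = subst₂ _≤_ (+-comm x z) (+-comm y z) (+-monoˡ-≤ z x≤y)

  +-mono-≤ : ∀ {x y u v} → x ≤ y → u ≤ v → x + u ≤ y + v
  +-mono-≤ {y = y} {u} x≤y u≤v = ≤-trans (+-monoˡ-≤ u x≤y) (+-monoʳ-≤ y u≤v)

  x≤y⇒0≤y-x : ∀ {x y} → x ≤ y → 0# ≤ y + - x
  x≤y⇒0≤y-x {x} {y} x≤y = subst (_≤ y + - x) (-‿inverseʳ x) (+-monoˡ-≤ (- x) x≤y)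

  0≤y-x⇒x≤y : ∀ {x y} → 0# ≤ y + - x → x ≤ y
  0≤y-x⇒x≤y {x} {y} 0≤y-x = subst₂ _≤_ (+-identityˡ x) y-x+x≡y (+-monoˡ-≤ x 0≤y-x)
    where
    y-x+x≡y : y + - x + x ≡ y
    y-x+x≡y = trans (+-assoc y (- x) x) (trans (cong (y +_) (-‿inverseˡ x)) (+-identityʳ y))

  x≤0⇒0≤-x : ∀ {x} → x ≤ 0# → 0# ≤ - x
  x≤0⇒0≤-x {x} x≤0 = subst (0# ≤_) (+-identityˡ (- x)) (x≤y⇒0≤y-x x≤0)

  -x≤0⇒0≤x : ∀ {x} → - x ≤ 0# → 0# ≤ x
  -x≤0⇒0≤x {x} -x≤0 = subst₂ _≤_ (-‿inverseˡ x) (+-identityˡ x) (+-monoˡ-≤ x -x≤0)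

  *-monoˡ-≤-nonNeg : ∀ {x y z} → 0# ≤ z → x ≤ y → x * z ≤ y * z
  *-monoˡ-≤-nonNeg {x} {y} {z} 0≤z x≤y =
    0≤y-x⇒x≤y (subst (0# ≤_) [y-x]z≡yz-xz (*-nonneg (x≤y⇒0≤y-x x≤y) 0≤z))
    where
    [y-x]z≡yz-xz : (y + - x) * z ≡ y * z + - (x * z)
    [y-x]z≡yz-xz = trans (distribʳ z y (- x)) (cong (y * z +_) (sym (-‿distribˡ-* x z)))

  *-monoʳ-≤-nonNeg : ∀ {x y z} → 0# ≤ z → x ≤ y → z * x ≤ z * y
  *-monoʳ-≤-nonNeg {x} {y} {z} 0≤z x≤y =
    subst₂ _≤_ (*-comm x z) (*-comm y z) (*-monoˡ-≤-nonNeg 0≤z x≤y)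

  0≤1 : 0# ≤ 1#
  0≤1 with total 0# 1#
  ... | inj₁ 0≤1 = 0≤1
  ... | inj₂ 1≤0 = subst (0# ≤_) [-1][-1]≡1 (*-nonneg (x≤0⇒0≤-x 1≤0) (x≤0⇒0≤-x 1≤0))
    where
    [-1][-1]≡1 : (- 1#) * (- 1#) ≡ 1#
    [-1][-1]≡1 = trans (sym (-‿distribˡ-* 1# (- 1#)))
                       (trans (cong -_ (*-identityˡ (- 1#))) (-‿involutive 1#))

  1≰0 : ¬ (1# ≤ 0#)
  1≰0 1≤0 = 0≢1 (antisym 0≤1 1≤0)

  *-cancelʳ-≡ : ∀ {x y z} → z ≢ 0# → x * z ≡ y * z → x ≡ y
  *-cancelʳ-≡ {x} {y} {z} z≢0 xz≡yz with inverse z z≢0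
  ... | z⁻¹ , zz⁻¹≡1 = begin
    x              ≡⟨ sym (*-identityʳ x) ⟩
    x * 1#         ≡⟨ cong (x *_) (sym zz⁻¹≡1) ⟩
    x * (z * z⁻¹)  ≡⟨ sym (*-assoc x z z⁻¹) ⟩
    x * z * z⁻¹    ≡⟨ cong (_* z⁻¹) xz≡yz ⟩
    y * z * z⁻¹    ≡⟨ *-assoc y z z⁻¹ ⟩
    y * (z * z⁻¹)  ≡⟨ cong (y *_) zz⁻¹≡1 ⟩
    y * 1#         ≡⟨ *-identityʳ y ⟩
    y              ∎
    where open ≡-Reasoning

  *-cancelʳ-≤-pos : ∀ {x y z} → 0# ≤ z → z ≢ 0# → x * z ≤ y * z → x ≤ y
  *-cancelʳ-≤-pos {x} {y} 0≤z z≢0 xz≤yz with total x y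
  ... | inj₁ x≤y = x≤y
  ... | inj₂ y≤x = ≤-reflexive (*-cancelʳ-≡ z≢0 (antisym xz≤yz (*-monoˡ-≤-nonNeg 0≤z y≤x)))

  0≤fromℕ : ∀ k → 0# ≤ fromℕ k
  0≤fromℕ N.zero    = ≤-refl
  0≤fromℕ (N.suc k) = subst (_≤ 1# + fromℕ k) (+-identityˡ 0#) (+-mono-≤ 0≤1 (0≤fromℕ k))

  fromℕ-suc≢0 : ∀ k → fromℕ (N.suc k) ≢ 0#
  fromℕ-suc≢0 k 1+k≡0 = 1≰0 (subst (1# ≤_) 1+k≡0 1≤1+k)
    where
    1≤1+k : 1# ≤ 1# + fromℕ k
    1≤1+k = subst (_≤ 1# + fromℕ k) (+-identityʳ 1#) (+-monoʳ-≤ 1# (0≤fromℕ k))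

  fromℕ-suc≰0 : ∀ k → ¬ (fromℕ (N.suc k) ≤ 0#)
  fromℕ-suc≰0 k 1+k≤0 = fromℕ-suc≢0 k (antisym 1+k≤0 (0≤fromℕ (N.suc k)))

  fromℕ-homo-+ : ∀ a b → fromℕ (a N.+ b) ≡ fromℕ a + fromℕ b
  fromℕ-homo-+ N.zero    b = sym (+-identityˡ (fromℕ b))
  fromℕ-homo-+ (N.suc a) b =
    trans (cong (1# +_) (fromℕ-homo-+ a b)) (sym (+-assoc 1# (fromℕ a) (fromℕ b)))

  fromℕ-homo-* : ∀ a b → fromℕ (a N.* b) ≡ fromℕ a * fromℕ b
  fromℕ-homo-* N.zero    b = sym (zeroˡ (fromℕ b))
  fromℕ-homo-* (N.suc a) b = begin
    fromℕ (b N.+ a N.* b)           ≡⟨ fromℕ-homo-+ b (a N.* b) ⟩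
    fromℕ b + fromℕ (a N.* b)       ≡⟨ cong₂ _+_ (sym (*-identityˡ (fromℕ b))) (fromℕ-homo-* a b) ⟩
    1# * fromℕ b + fromℕ a * fromℕ b ≡⟨ sym (distribʳ (fromℕ b) 1# (fromℕ a)) ⟩
    (1# + fromℕ a) * fromℕ b        ∎
    where open ≡-Reasoning

  fromℕ-homo-^ : ∀ a k → fromℕ (a N.^ k) ≡ fromℕ a ^ k
  fromℕ-homo-^ a N.zero    = +-identityʳ 1#
  fromℕ-homo-^ a (N.suc k) = trans (fromℕ-homo-* a (a N.^ k)) (cong (fromℕ a *_) (fromℕ-homo-^ a k))

  fromℕ-mono-≤ : ∀ {a b} → a N.≤ b → fromℕ a ≤ fromℕ b
  fromℕ-mono-≤ {a} {b} a≤b = subst₂ _≤_ (+-identityʳ (fromℕ a)) a+[b-a]≡b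
    (+-monoʳ-≤ (fromℕ a) (0≤fromℕ (b N.∸ a)))
    where
    a+[b-a]≡b : fromℕ a + fromℕ (b N.∸ a) ≡ fromℕ b
    a+[b-a]≡b = trans (sym (fromℕ-homo-+ a (b N.∸ a))) (cong fromℕ (ℕₚ.m+[n∸m]≡n a≤b))

  ^-nonNeg : ∀ {x} k → 0# ≤ x → 0# ≤ x ^ k
  ^-nonNeg N.zero    0≤x = 0≤1
  ^-nonNeg (N.suc k) 0≤x = *-nonneg 0≤x (^-nonNeg k 0≤x)

  ^-monoˡ-≤ : ∀ {x y} k → 0# ≤ x → x ≤ y → x ^ k ≤ y ^ k
  ^-monoˡ-≤ N.zero    0≤x x≤y = ≤-refl
  ^-monoˡ-≤ (N.suc k) 0≤x x≤y = ≤-trans (*-monoˡ-≤-nonNeg (^-nonNeg k 0≤x) x≤y)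
                                         (*-monoʳ-≤-nonNeg (≤-trans 0≤x x≤y) (^-monoˡ-≤ k 0≤x x≤y))

  ^-distribˡ-+-* : ∀ x a b → x ^ (a N.+ b) ≡ x ^ a * x ^ b
  ^-distribˡ-+-* x N.zero    b = sym (*-identityˡ (x ^ b))
  ^-distribˡ-+-* x (N.suc a) b = trans (cong (x *_) (^-distribˡ-+-* x a b)) (sym (*-assoc x (x ^ a) (x ^ b)))

  ^-distribʳ-* : ∀ x y k → (x * y) ^ k ≡ x ^ k * y ^ k
  ^-distribʳ-* x y N.zero    = sym (*-identityˡ 1#)
  ^-distribʳ-* x y (N.suc k) = trans (cong ((x * y) *_) (^-distribʳ-* x y k))
    (solve 4 (λ x y a b → (x :* y) :* (a :* b) := (x :* a) :* (y :* b)) refl x y (x ^ k) (y ^ k))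

  ^≤1 : ∀ {x} k → 0# ≤ x → x ≤ 1# → x ^ k ≤ 1#
  ^≤1 N.zero    0≤x x≤1 = ≤-refl
  ^≤1 {x} (N.suc k) 0≤x x≤1 = subst (x ^ N.suc k ≤_) (*-identityˡ 1#)
    (≤-trans (*-monoˡ-≤-nonNeg (^-nonNeg k 0≤x) x≤1) (*-monoʳ-≤-nonNeg 0≤1 (^≤1 k 0≤x x≤1)))

  ^-antimonoʳ-≤ : ∀ {x a b} → 0# ≤ x → x ≤ 1# → a N.≤ b → x ^ b ≤ x ^ a
  ^-antimonoʳ-≤ {x} {a} {b} 0≤x x≤1 a≤b =
    subst₂ _≤_ x^a*x^[b-a]≡x^b (*-identityʳ (x ^ a))
      (*-monoʳ-≤-nonNeg (^-nonNeg a 0≤x) (^≤1 (b N.∸ a) 0≤x x≤1))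
    where
    x^a*x^[b-a]≡x^b : x ^ a * x ^ (b N.∸ a) ≡ x ^ b
    x^a*x^[b-a]≡x^b = trans (sym (^-distribˡ-+-* x a (b N.∸ a))) (cong (x ^_) (ℕₚ.m+[n∸m]≡n a≤b))

  -x*-y≡x*y : ∀ x y → - x * - y ≡ x * y
  -x*-y≡x*y x y = trans (sym (-‿distribˡ-* x (- y)))
                        (trans (cong -_ (sym (-‿distribʳ-* x y))) (-‿involutive (x * y)))

  x*y≡0⇒y≡0 : ∀ {x y} → x ≢ 0# → x * y ≡ 0# → y ≡ 0#
  x*y≡0⇒y≡0 {x} {y} x≢0 xy≡0 = *-cancelʳ-≡ x≢0 (trans (*-comm y x) (trans xy≡0 (sym (zeroˡ x))))

  ^≢0 : ∀ {x} k → x ≢ 0# → x ^ k ≢ 0#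
  ^≢0 N.zero    x≢0 1≡0 = 0≢1 (sym 1≡0)
  ^≢0 (N.suc k) x≢0     = ^≢0 k x≢0 ∘ x*y≡0⇒y≡0 x≢0

  ^-cancel-fromℕ : ∀ {x y} k c → 0# ≤ y → (x * fromℕ c) ^ N.suc k ≤ fromℕ c ^ k * y →
                   x ^ N.suc k * fromℕ c ≤ y
  ^-cancel-fromℕ {x} {y} k N.zero      0≤y _   = subst (_≤ y) (sym (zeroʳ (x ^ N.suc k))) 0≤y
  ^-cancel-fromℕ {x} {y} k (N.suc c′)  _   [xc]^[1+k]≤c^k*y =
    *-cancelʳ-≤-pos (^-nonNeg k (0≤fromℕ c)) (^≢0 k (fromℕ-suc≢0 c′))
      (subst₂ _≤_ [xc]^[1+k]≡x^[1+k]*c*c^k (*-comm (fromℕ c ^ k) y) [xc]^[1+k]≤c^k*y)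
    where
    c = N.suc c′
    [xc]^[1+k]≡x^[1+k]*c*c^k : (x * fromℕ c) ^ N.suc k ≡ x ^ N.suc k * fromℕ c * fromℕ c ^ k
    [xc]^[1+k]≡x^[1+k]*c*c^k =
      trans (^-distribʳ-* x (fromℕ c) (N.suc k)) (sym (*-assoc (x ^ N.suc k) (fromℕ c) (fromℕ c ^ k)))

-- The least upper bound property decides equality constructively: the supremum of
-- {0} ∪ {2 | Q} is ≤ 1 or ≥ 1, which yields ¬ Q or ¬ ¬ Q, and the supremum s of
-- {k x | k ∈ ℕ} satisfies s ≤ s - x, so ¬ ¬ (x ≡ 0) already forces x ≤ 0.
module DecidableEquality (F : CompleteOrderedField) where
  open CompleteOrderedField F
  open OrderedFieldProperties F

  weak-excluded-middle : (Q : Set) → ¬ Q ⊎ ¬ ¬ Q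
  weak-excluded-middle Q = Sum.map (λ s≤1 q → 2≰1 (≤-trans (s-upper 2# (inj₂ (refl , q))) s≤1))
                                  (λ 1≤s ¬q → 1≰0 (≤-trans 1≤s (s-least 0# (S≤0 ¬q))))
                                  (total s 1#)
    where
    2# : Carrier
    2# = 1# + 1#
    S : Carrier → Set
    S y = y ≡ 0# ⊎ (y ≡ 2# × Q)
    S≤2 : ∀ y → S y → y ≤ 2#
    S≤2 y (inj₁ refl)       = subst (_≤ 2#) (+-identityˡ 0#) (+-mono-≤ 0≤1 0≤1)
    S≤2 y (inj₂ (refl , _)) = ≤-refl
    S≤0 : ¬ Q → ∀ y → S y → y ≤ 0#
    S≤0 ¬q y (inj₁ refl)    = ≤-refl
    S≤0 ¬q y (inj₂ (_ , q)) = ⊥-elim (¬q q)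
    sup = lub S (0# , inj₁ refl) (2# , S≤2)
    s = proj₁ sup
    s-upper = proj₁ (proj₂ sup)
    s-least = proj₂ (proj₂ sup)
    2≰1 : ¬ (2# ≤ 1#)
    2≰1 2≤1 = 1≰0 (subst₂ _≤_ 2-1≡1 (-‿inverseʳ 1#) (+-monoˡ-≤ (- 1#) 2≤1))
      where
      2-1≡1 : 2# + - 1# ≡ 1#
      2-1≡1 = trans (+-assoc 1# 1# (- 1#)) (trans (cong (1# +_) (-‿inverseʳ 1#)) (+-identityʳ 1#))

  ¬¬x≡0⇒x≤0 : ∀ x → ¬ ¬ (x ≡ 0#) → x ≤ 0#
  ¬¬x≡0⇒x≤0 x ¬¬x≡0 = 0≤y-x⇒x≤y (subst (0# ≤_) s-x-s≡0-x (x≤y⇒0≤y-x s≤s-x))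
    where
    S : Carrier → Set
    S y = ∃ λ k → y ≡ fromℕ k * x
    S≤1 : ∀ y → S y → y ≤ 1#
    S≤1 y (k , refl) with total (fromℕ k * x) 1#
    ... | inj₁ kx≤1 = kx≤1
    ... | inj₂ 1≤kx = ⊥-elim (¬¬x≡0 λ x≡0 →
                        1≰0 (subst (1# ≤_) (trans (cong (fromℕ k *_) x≡0) (zeroʳ (fromℕ k))) 1≤kx))
    sup = lub S (0# , 0 , sym (zeroˡ x)) (1# , S≤1)
    s = proj₁ sup
    s-upper = proj₁ (proj₂ sup)
    s-least = proj₂ (proj₂ sup)
    [1+k]x-x≡kx : ∀ k → (1# + fromℕ k) * x + - x ≡ fromℕ k * x
    [1+k]x-x≡kx k = begin
      (1# + fromℕ k) * x + - x      ≡⟨ solve 4 (λ o a x z → (o :+ a) :* x :+ z := a :* x :+ (o :* x :+ z))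
                                                refl 1# (fromℕ k) x (- x) ⟩
      fromℕ k * x + (1# * x + - x)  ≡⟨ cong (λ t → fromℕ k * x + (t + - x)) (*-identityˡ x) ⟩
      fromℕ k * x + (x + - x)       ≡⟨ cong (fromℕ k * x +_) (-‿inverseʳ x) ⟩
      fromℕ k * x + 0#              ≡⟨ +-identityʳ _ ⟩
      fromℕ k * x                   ∎
      where open ≡-Reasoning
    S≤s-x : ∀ y → S y → y ≤ s + - x
    S≤s-x _ (k , refl) = subst (_≤ s + - x) ([1+k]x-x≡kx k) (+-monoˡ-≤ (- x) (s-upper _ (N.suc k , refl)))
    s≤s-x : s ≤ s + - x
    s≤s-x = s-least (s + - x) S≤s-x
    s-x-s≡0-x : s + - x + - s ≡ 0# + - x
    s-x-s≡0-x = trans (solve 3 (λ s a b → s :+ a :+ b := a :+ (s :+ b)) refl s (- x) (- s))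
                      (trans (cong (- x +_) (-‿inverseʳ s)) (+-comm (- x) 0#))

  ¬¬x≡0⇒x≡0 : ∀ x → ¬ ¬ (x ≡ 0#) → x ≡ 0#
  ¬¬x≡0⇒x≡0 x ¬¬x≡0 = antisym (¬¬x≡0⇒x≤0 x ¬¬x≡0) (-x≤0⇒0≤x (¬¬x≡0⇒x≤0 (- x) ¬¬-x≡0))
    where
    ¬¬-x≡0 : ¬ ¬ (- x ≡ 0#)
    ¬¬-x≡0 -x≢0 = ¬¬x≡0 λ x≡0 → -x≢0 (trans (cong -_ x≡0) -0#≈0#)

  _≟0 : ∀ x → Dec (x ≡ 0#)
  x ≟0 with weak-excluded-middle (x ≡ 0#)
  ... | inj₁ x≢0   = no x≢0
  ... | inj₂ ¬¬x≡0 = yes (¬¬x≡0⇒x≡0 x ¬¬x≡0)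

  _≟_ : DecidableEquality Carrier
  x ≟ y with (x + - y) ≟0
  ... | yes x-y≡0 = yes (x∙y⁻¹≈ε⇒x≈y x y x-y≡0)
  ... | no x-y≢0  = no λ x≡y → x-y≢0 (x≈y⇒x∙y⁻¹≈ε x≡y)

module TriangularSystems (F : CompleteOrderedField) where
  open CompleteOrderedField F
  open OrderedFieldProperties F
  open DecidableEquality F

  Nonzero : ∀ {N} → Vec Carrier N → Set
  Nonzero w = ¬ VAll.All (_≡ 0#) w

  AnnihilatedBy : ∀ {N} → Vec Carrier N → List (Vec Carrier N × Vec Carrier N) → Set
  AnnihilatedBy w = All λ (_ , v) → dot w v ≡ 0#

  Triangular : ∀ {N} → List (Vec Carrier N × Vec Carrier N) → Set
  Triangular []             = ⊤
  Triangular ((w , v) ∷ xs) = dot w v ≢ 0# × AnnihilatedBy w xs × Triangular xs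

  dot≢0⇒nonzero : ∀ {N} (w v : Vec Carrier N) → dot w v ≢ 0# → Nonzero w
  dot≢0⇒nonzero []       []       wv≢0 _           = wv≢0 refl
  dot≢0⇒nonzero (w₀ ∷ w) (v₀ ∷ v) wv≢0 (refl VAll.∷ w≡0) = dot≢0⇒nonzero w v wv≢0' w≡0
    where
    wv≢0' : dot w v ≢ 0#
    wv≢0' wv≡0 = wv≢0 (trans (cong₂ _+_ (zeroˡ v₀) wv≡0) (+-identityˡ 0#))

  dot-linearˡ : ∀ {N} (u w x : Vec Carrier N) c →
                dot (zipWith _+_ u (map (c *_) w)) x ≡ dot u x + c * dot w x
  dot-linearˡ []       []       []       c = sym (trans (cong (0# +_) (zeroʳ c)) (+-identityʳ 0#))
  dot-linearˡ (u₀ ∷ u) (w₀ ∷ w) (x₀ ∷ x) c = trans (cong ((u₀ + c * w₀) * x₀ +_) (dot-linearˡ u w x c))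
    (solve 6 (λ u₀ c w₀ x₀ a b → (u₀ :+ c :* w₀) :* x₀ :+ (a :+ c :* b)
                                := u₀ :* x₀ :+ a :+ c :* (w₀ :* x₀ :+ b))
           refl u₀ c w₀ x₀ (dot u x) (dot w x))

  -- Coordinates on the hyperplane ⟨w,x⟩ = 0, together with the matching restriction of linear forms.
  record Projection {N} (w : Vec Carrier (N.suc N)) : Set where
    field
      project      : Vec Carrier (N.suc N) → Vec Carrier N
      restrict     : Vec Carrier (N.suc N) → Vec Carrier N
      dot-restrict : ∀ u x → dot w x ≡ 0# → dot (restrict u) (project x) ≡ dot u x

  projection : ∀ {N} (w : Vec Carrier (N.suc N)) → Nonzero w → Projection w
  projection (w₀ ∷ w) w≢0 with w₀ ≟0
  ... | no w₀≢0 with inverse w₀ w₀≢0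
  ...   | w₀⁻¹ , w₀w₀⁻¹≡1 = record { project = tail ; restrict = restrict ; dot-restrict = dot-restrict }
    where
    restrict : Vec Carrier _ → Vec Carrier _
    restrict (u₀ ∷ u) = zipWith _+_ u (map (- (u₀ * w₀⁻¹) *_) w)
    dot-restrict : ∀ u x → dot (w₀ ∷ w) x ≡ 0# → dot (restrict u) (tail x) ≡ dot u x
    dot-restrict (u₀ ∷ u) (x₀ ∷ x) wx≡0 = begin
      dot (restrict (u₀ ∷ u)) x                   ≡⟨ dot-linearˡ u w x _ ⟩
      dot u x + - (u₀ * w₀⁻¹) * dot w x           ≡⟨ cong (λ t → dot u x + - (u₀ * w₀⁻¹) * t)
                                                         (+-inverseʳ-unique _ _ wx≡0) ⟩
      dot u x + - (u₀ * w₀⁻¹) * - (w₀ * x₀)       ≡⟨ cong (dot u x +_) (-x*-y≡x*y _ _) ⟩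
      dot u x + u₀ * w₀⁻¹ * (w₀ * x₀)             ≡⟨ cong (dot u x +_) (solve 4 (λ a b c d → (a :* b) :* (c :* d)
                                                                                   := (a :* d) :* (c :* b))
                                                                          refl u₀ w₀⁻¹ w₀ x₀) ⟩
      dot u x + u₀ * x₀ * (w₀ * w₀⁻¹)             ≡⟨ cong (λ t → dot u x + u₀ * x₀ * t) w₀w₀⁻¹≡1 ⟩
      dot u x + u₀ * x₀ * 1#                      ≡⟨ cong (dot u x +_) (*-identityʳ _) ⟩
      dot u x + u₀ * x₀                           ≡⟨ +-comm _ _ ⟩
      u₀ * x₀ + dot u x                           ∎
      where open ≡-Reasoning
  projection {N.zero}  (w₀ ∷ []) w≢0 | yes w₀≡0 = ⊥-elim (w≢0 (w₀≡0 VAll.∷ VAll.[]))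
  projection {N.suc N} (w₀ ∷ w)  w≢0 | yes w₀≡0 =
    record { project = project ; restrict = restrict ; dot-restrict = dot-restrict }
    where
    module P = Projection (projection w λ w≡0 → w≢0 (w₀≡0 VAll.∷ w≡0))
    project restrict : Vec Carrier (N.suc (N.suc N)) → Vec Carrier (N.suc N)
    project  (x₀ ∷ x) = x₀ ∷ P.project x
    restrict (u₀ ∷ u) = u₀ ∷ P.restrict u
    w₀x₀+wx≡wx : ∀ x₀ x → w₀ * x₀ + dot w x ≡ dot w x
    w₀x₀+wx≡wx x₀ x = trans (cong (λ t → t * x₀ + dot w x) w₀≡0)
                            (trans (cong (_+ dot w x) (zeroˡ x₀)) (+-identityˡ _))
    dot-restrict : ∀ u x → dot (w₀ ∷ w) x ≡ 0# → dot (restrict u) (project x) ≡ dot u x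
    dot-restrict (u₀ ∷ u) (x₀ ∷ x) wx≡0 =
      cong (u₀ * x₀ +_) (P.dot-restrict u x (trans (sym (w₀x₀+wx≡wx x₀ x)) wx≡0))

  module _ {N} {w : Vec Carrier (N.suc N)} (P : Projection w) where
    open Projection P

    projectPairs : List (Vec Carrier (N.suc N) × Vec Carrier (N.suc N)) → List (Vec Carrier N × Vec Carrier N)
    projectPairs = List.map λ (u , x) → restrict u , project x

    projectPairs-annihilatedBy : ∀ {u} xs → AnnihilatedBy w xs → AnnihilatedBy u xs →
                                 AnnihilatedBy (restrict u) (projectPairs xs)
    projectPairs-annihilatedBy []             []          []          = []
    projectPairs-annihilatedBy {u} ((_ , x) ∷ xs) (wx≡0 ∷ w⊥) (ux≡0 ∷ u⊥) =
      trans (dot-restrict u x wx≡0) ux≡0 ∷ projectPairs-annihilatedBy xs w⊥ u⊥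

    projectPairs-triangular : ∀ xs → AnnihilatedBy w xs → Triangular xs → Triangular (projectPairs xs)
    projectPairs-triangular []             []          _                    = _
    projectPairs-triangular ((u , x) ∷ xs) (wx≡0 ∷ w⊥) (ux≢0 , u⊥ , xs-tri) =
      (λ ux≡0 → ux≢0 (trans (sym (dot-restrict u x wx≡0)) ux≡0)) ,
      projectPairs-annihilatedBy xs w⊥ u⊥ , projectPairs-triangular xs w⊥ xs-tri

  -- The vs of a triangular family are linearly independent.
  triangular-length≤ : ∀ {N} xs → Triangular {N} xs → List.length xs N.≤ N
  annihilated-length< : ∀ {N} {w : Vec Carrier N} → Nonzero w → ∀ xs → AnnihilatedBy w xs →
                        Triangular xs → List.length xs N.< N

  triangular-length≤ []             _                  = N.z≤n
  triangular-length≤ ((w , v) ∷ xs) (wv≢0 , w⊥ , tri) = annihilated-length< (dot≢0⇒nonzero w v wv≢0) xs w⊥ tri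

  annihilated-length< {N.zero}  {[]} w≢0 _ _ _ = ⊥-elim (w≢0 VAll.[])
  annihilated-length< {N.suc N} {w}  w≢0 xs w⊥ tri = N.s≤s
    (subst (N._≤ N) (ListP.length-map _ xs) (triangular-length≤ _ (projectPairs-triangular P xs w⊥ tri)))
    where
    P = projection w w≢0

module FinSums where
  open import Data.Nat using (_+_; _*_; _^_; _∸_; _≤_; _<_; z≤n; s≤s)
  open import Data.Nat.Properties
  open import Data.Nat.Tactic.RingSolver using (solve-∀)
  open import Data.Fin as Fin using (zero; suc)
  open import Data.List using (allFin; tabulate; filter)
  open import Data.List.Extrema.Nat using (argmax; f[xs]≤f[argmax])
  open import Data.List.Membership.Propositional.Properties using (∈-allFin)
  open import Data.List.Relation.Unary.Unique.Propositional using (Unique)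
  open import Data.List.Relation.Unary.AllPairs using (_∷_)
  open import Data.Product.Properties using (≡-dec)
  open import Function using (_∘_)
  open import Relation.Unary using (Pred; Decidable)
  open import Algebra.Properties.Semiring.Sum +-*-semiring public
    using (sum; sum-syntax; ∑-distrib-+; ∑-comm; *-distribˡ-sum; *-distribʳ-sum; sum-cong-≗)

  sum-const : ∀ k c → ∑[ i < k ] c ≡ k * c
  sum-const N.zero    c = refl
  sum-const (N.suc k) c = cong (c +_) (sum-const k c)

  sum-mono-≤ : ∀ {k} {f g : Fin k → ℕ} → (∀ i → f i ≤ g i) → sum f ≤ sum g
  sum-mono-≤ {N.zero}  f≤g = z≤n
  sum-mono-≤ {N.suc k} f≤g = +-mono-≤ (f≤g zero) (sum-mono-≤ (f≤g ∘ suc))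

  sum-mono-< : ∀ {k} {f g : Fin k → ℕ} i → (∀ j → f j ≤ g j) → f i < g i → sum f < sum g
  sum-mono-< zero    f≤g fi<gi = +-mono-<-≤ fi<gi (sum-mono-≤ (f≤g ∘ suc))
  sum-mono-< (suc i) f≤g fi<gi = +-mono-≤-< (f≤g zero) (sum-mono-< i (f≤g ∘ suc) fi<gi)

  sum≤size*max : ∀ {k} → Fin k → (f : Fin k → ℕ) → ∃ λ i → sum f ≤ k * f i
  sum≤size*max {k} i₀ f = i , ≤-trans (sum-mono-≤ f≤fi) (≤-reflexive (sum-const k (f i)))
    where
    i = argmax f i₀ (allFin _)
    f≤fi : ∀ j → f j ≤ f i
    f≤fi j = All.lookup (f[xs]≤f[argmax] {f = f} i₀ (allFin _)) (∈-allFin j)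

  indicator : ∀ {ℓ} {Q : Set ℓ} → Dec Q → ℕ
  indicator (yes _) = 1
  indicator (no _)  = 0

  indicator-mono : ∀ {Q R : Set} → (Q → R) → (q : Dec Q) (r : Dec R) → indicator q ≤ indicator r
  indicator-mono Q⇒R (yes _) (yes _) = ≤-refl
  indicator-mono Q⇒R (yes q) (no ¬r) = ⊥-elim (¬r (Q⇒R q))
  indicator-mono Q⇒R (no _)  _       = z≤n

  indicator-× : ∀ {Q R S : Set} → (S → Q × R) → (Q → R → S) → (s : Dec S) (q : Dec Q) (r : Dec R) →
                indicator s ≡ indicator q * indicator r
  indicator-× S⇒Q×R Q⇒R⇒S (yes s) (yes _) (yes _) = refl
  indicator-× S⇒Q×R Q⇒R⇒S (yes s) (yes _) (no ¬r) = ⊥-elim (¬r (proj₂ (S⇒Q×R s)))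
  indicator-× S⇒Q×R Q⇒R⇒S (yes s) (no ¬q) _       = ⊥-elim (¬q (proj₁ (S⇒Q×R s)))
  indicator-× S⇒Q×R Q⇒R⇒S (no ¬s) (yes q) (yes r) = ⊥-elim (¬s (Q⇒R⇒S q r))
  indicator-× S⇒Q×R Q⇒R⇒S (no ¬s) (yes _) (no _)  = refl
  indicator-× S⇒Q×R Q⇒R⇒S (no ¬s) (no _)  _       = refl

  length-filter-tabulate : ∀ {a ℓ} {A : Set a} {P : Pred A ℓ} (P? : Decidable P) {k} (f : Fin k → A) →
                           List.length (filter P? (tabulate f)) ≡ ∑[ i < k ] indicator (P? (f i))
  length-filter-tabulate P? {N.zero}  f = refl
  length-filter-tabulate P? {N.suc k} f with P? (f zero)
  ... | yes _ = cong N.suc (length-filter-tabulate P? (f ∘ suc))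
  ... | no _  = length-filter-tabulate P? (f ∘ suc)

  1≤indicator : ∀ {ℓ} {Q : Set ℓ} → Q → (q : Dec Q) → 1 ≤ indicator q
  1≤indicator q (yes _) = ≤-refl
  1≤indicator q (no ¬q) = ⊥-elim (¬q q)

  module _ {a b : ℕ} where
    vanishAt : Fin a × Fin b → (Fin a → Fin b → ℕ) → Fin a → Fin b → ℕ
    vanishAt x g i j with ≡-dec Fin._≟_ Fin._≟_ (i , j) x
    ... | yes _ = 0
    ... | no _  = g i j

    vanishAt≤ : ∀ x g i j → vanishAt x g i j ≤ g i j
    vanishAt≤ x g i j with ≡-dec Fin._≟_ Fin._≟_ (i , j) x
    ... | yes _ = z≤n
    ... | no _  = ≤-refl

    vanishAt-self : ∀ i j g → vanishAt (i , j) g i j ≡ 0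
    vanishAt-self i j g with ≡-dec Fin._≟_ Fin._≟_ (i , j) (i , j)
    ... | yes _  = refl
    ... | no ¬eq = ⊥-elim (¬eq refl)

    vanishAt-other : ∀ x g i j → x ≢ (i , j) → vanishAt x g i j ≡ g i j
    vanishAt-other x g i j x≢ij with ≡-dec Fin._≟_ Fin._≟_ (i , j) x
    ... | yes ij≡x = ⊥-elim (x≢ij (sym ij≡x))
    ... | no _     = refl

    length-unique≤∑∑ : (xs : List (Fin a × Fin b)) (g : Fin a → Fin b → ℕ) → Unique xs →
                       All (λ (i , j) → 1 ≤ g i j) xs → List.length xs ≤ ∑[ i < a ] ∑[ j < b ] g i j
    length-unique≤∑∑ []             g _                  _             = z≤n
    length-unique≤∑∑ ((i , j) ∷ xs) g (ij∉xs ∷ xs-unique) (1≤gij ∷ 1≤g) =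
      ≤-trans (s≤s (length-unique≤∑∑ xs g′ xs-unique (1≤g′ xs ij∉xs 1≤g))) ∑∑g′<∑∑g
      where
      g′ = vanishAt (i , j) g
      1≤g′ : ∀ ys → All ((i , j) ≢_) ys → All (λ (i , j) → 1 ≤ g i j) ys →
             All (λ (i , j) → 1 ≤ g′ i j) ys
      1≤g′ []              _                   _           = []
      1≤g′ ((i′ , j′) ∷ ys) (ij≢i′j′ ∷ ij≢ys) (1≤gi′j′ ∷ 1≤gys) =
        subst (1 ≤_) (sym (vanishAt-other (i , j) g i′ j′ ij≢i′j′)) 1≤gi′j′ ∷ 1≤g′ ys ij≢ys 1≤gys
      ∑∑g′<∑∑g : ∑[ i < a ] ∑[ j < b ] g′ i j < ∑[ i < a ] ∑[ j < b ] g i j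
      ∑∑g′<∑∑g = sum-mono-< i (λ i′ → sum-mono-≤ (vanishAt≤ (i , j) g i′))
                   (sum-mono-< j (vanishAt≤ (i , j) g i)
                     (subst (_< g i j) (sym (vanishAt-self i j g)) 1≤gij))

  x*y^k+y*x^k≤x^[1+k]+y^[1+k] : ∀ x y k → x * y ^ k + y * x ^ k ≤ x ^ N.suc k + y ^ N.suc k
  x*y^k+y*x^k≤x^[1+k]+y^[1+k] x y k =
    [ ordered , (λ y≤x → subst₂ _≤_ (+-comm (y * x ^ k) _) (+-comm (y ^ N.suc k) _) (ordered y≤x)) ]′
      (≤-total x y)
    where
    ordered : ∀ {x y} → x ≤ y → x * y ^ k + y * x ^ k ≤ x ^ N.suc k + y ^ N.suc k
    ordered {x} {y} x≤y =
      subst (λ y → x * y ^ k + y * x ^ k ≤ x ^ N.suc k + y ^ N.suc k) (m+[n∸m]≡n x≤y) (shifted (y ∸ x))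
      where
      shifted : ∀ t → x * (x + t) ^ k + (x + t) * x ^ k ≤ x * x ^ k + (x + t) * (x + t) ^ k
      shifted t = subst₂ _≤_ (lhs x t ((x + t) ^ k) (x ^ k)) (rhs x t ((x + t) ^ k) (x ^ k))
        (+-monoʳ-≤ (x * (x + t) ^ k + x * x ^ k) (*-monoʳ-≤ t (^-monoˡ-≤ k (m≤m+n x t))))
        where
        lhs : ∀ x t u v → x * u + x * v + t * v ≡ x * u + (x + t) * v
        lhs = solve-∀
        rhs : ∀ x t u v → x * u + x * v + t * u ≡ x * v + (x + t) * u
        rhs = solve-∀

  ∑∑-* : ∀ {m} (f g : Fin m → ℕ) → ∑[ i < m ] ∑[ j < m ] (f i * g j) ≡ sum f * sum g
  ∑∑-* f g = trans (sum-cong-≗ (λ i → sym (*-distribˡ-sum (f i) g))) (sym (*-distribʳ-sum (sum g) f))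

  chebyshev : ∀ {m} k (x : Fin m → ℕ) → sum x * ∑[ i < m ] (x i ^ k) ≤ m * ∑[ i < m ] (x i ^ N.suc k)
  chebyshev {m} k x = *-cancelˡ-≤ 2 (begin
    2 * (sum x * sum y)                               ≡⟨ double (sum x * sum y) ⟩
    sum x * sum y + sum x * sum y
      ≡⟨ cong₂ _+_ (∑∑-* x y) (trans (∑∑-* y x) (*-comm (sum y) (sum x))) ⟨
    ∑[ i < m ] ∑[ j < m ] (x i * y j) + ∑[ i < m ] ∑[ j < m ] (y i * x j)
                                                      ≡⟨ ∑∑-distrib-+ (λ i j → x i * y j) (λ i j → y i * x j) ⟨
    ∑[ i < m ] ∑[ j < m ] (x i * y j + y i * x j)      ≤⟨ sum-mono-≤ (λ i → sum-mono-≤ λ j →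
                                                           subst (_≤ z i + z j) (cong (x i * y j +_) (*-comm (x j) (y i)))
                                                             (x*y^k+y*x^k≤x^[1+k]+y^[1+k] (x i) (x j) k)) ⟩
    ∑[ i < m ] ∑[ j < m ] (z i + z j)                  ≡⟨ ∑∑-distrib-+ (λ i j → z i) (λ i j → z j) ⟩
    ∑[ i < m ] ∑[ j < m ] z i + ∑[ i < m ] sum z
      ≡⟨ cong₂ _+_ (sum-cong-≗ λ i → sum-const m (z i)) (sum-const m (sum z)) ⟩
    ∑[ i < m ] (m * z i) + m * sum z                     ≡⟨ cong (_+ m * sum z) (*-distribˡ-sum m z) ⟨
    m * sum z + m * sum z                              ≡⟨ double (m * sum z) ⟨
    2 * (m * sum z)                                    ∎)
    where
    open ≤-Reasoning
    y z : Fin m → ℕ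
    y i = x i ^ k
    z i = x i ^ N.suc k
    double : ∀ t → 2 * t ≡ t + t
    double = solve-∀
    ∑∑-distrib-+ : (f g : Fin m → Fin m → ℕ) →
                   ∑[ i < m ] ∑[ j < m ] (f i j + g i j) ≡ ∑[ i < m ] ∑[ j < m ] f i j + ∑[ i < m ] ∑[ j < m ] g i j
    ∑∑-distrib-+ f g = trans (sum-cong-≗ λ i → ∑-distrib-+ (f i) (g i))
                             (∑-distrib-+ (λ i → ∑[ j < m ] f i j) (λ i → ∑[ j < m ] g i j))

  power-mean : ∀ {m} k (x : Fin m → ℕ) → sum x ^ N.suc k ≤ m ^ k * ∑[ i < m ] (x i ^ N.suc k)
  power-mean {m} N.zero    x = ≤-reflexive (begin
    sum x * 1                    ≡⟨ *-identityʳ (sum x) ⟩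
    sum x                        ≡⟨ sum-cong-≗ (λ i → *-identityʳ (x i)) ⟨
    ∑[ i < m ] (x i * 1)           ≡⟨ *-identityˡ _ ⟨
    1 * ∑[ i < m ] (x i * 1)       ∎)
    where open ≡-Reasoning
  power-mean {m} (N.suc k) x = begin
    sum x * sum x ^ N.suc k                          ≤⟨ *-monoʳ-≤ (sum x) (power-mean k x) ⟩
    sum x * (m ^ k * ∑[ i < m ] (x i ^ N.suc k))       ≡⟨ x*[y*z]≡y*[x*z] (sum x) (m ^ k) _ ⟩
    m ^ k * (sum x * ∑[ i < m ] (x i ^ N.suc k))       ≤⟨ *-monoʳ-≤ (m ^ k) (chebyshev (N.suc k) x) ⟩
    m ^ k * (m * ∑[ i < m ] (x i ^ N.suc (N.suc k)))   ≡⟨ x*[y*z]≡y*[x*z] (m ^ k) m _ ⟩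
    m * (m ^ k * ∑[ i < m ] (x i ^ N.suc (N.suc k)))   ≡⟨ *-assoc m (m ^ k) _ ⟨
    m * m ^ k * ∑[ i < m ] (x i ^ N.suc (N.suc k))     ∎
    where
    open ≤-Reasoning
    x*[y*z]≡y*[x*z] : ∀ x y z → x * (y * z) ≡ y * (x * z)
    x*[y*z]≡y*[x*z] = solve-∀

module TupleSums (n : ℕ) where
  open import Data.Nat using (_+_; _*_; _^_; _≤_; z≤n)
  open import Data.Nat.Properties
  open import Data.List using (List; length)
  open import Relation.Unary using (Decidable)
  open FinSums

  sumTuples : ℕ → (List (Fin n) → ℕ) → ℕ
  sumTuples N.zero    f = f []
  sumTuples (N.suc k) f = sumTuples k λ T → ∑[ p < n ] f (p ∷ T)

  sumTuples-cong : ∀ k {f g : List (Fin n) → ℕ} → (∀ T → f T ≡ g T) → sumTuples k f ≡ sumTuples k g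
  sumTuples-cong N.zero    f≗g = f≗g []
  sumTuples-cong (N.suc k) f≗g = sumTuples-cong k λ T → sum-cong-≗ λ p → f≗g (p ∷ T)

  sumTuples-mono-≤ : ∀ k {f g : List (Fin n) → ℕ} → (∀ T → length T ≡ k → f T ≤ g T) →
                     sumTuples k f ≤ sumTuples k g
  sumTuples-mono-≤ N.zero    f≤g = f≤g [] refl
  sumTuples-mono-≤ (N.suc k) f≤g =
    sumTuples-mono-≤ k λ T |T|≡k → sum-mono-≤ λ p → f≤g (p ∷ T) (cong N.suc |T|≡k)

  sumTuples-distrib-+ : ∀ k (f g : List (Fin n) → ℕ) →
                        sumTuples k (λ T → f T + g T) ≡ sumTuples k f + sumTuples k g
  sumTuples-distrib-+ N.zero    f g = refl
  sumTuples-distrib-+ (N.suc k) f g =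
    trans (sumTuples-cong k λ T → ∑-distrib-+ (λ p → f (p ∷ T)) (λ p → g (p ∷ T)))
          (sumTuples-distrib-+ k (λ T → ∑[ p < n ] f (p ∷ T)) (λ T → ∑[ p < n ] g (p ∷ T)))

  *-distribˡ-sumTuples : ∀ k c (f : List (Fin n) → ℕ) → c * sumTuples k f ≡ sumTuples k (λ T → c * f T)
  *-distribˡ-sumTuples N.zero    c f = refl
  *-distribˡ-sumTuples (N.suc k) c f =
    trans (*-distribˡ-sumTuples k c (λ T → ∑[ p < n ] f (p ∷ T)))
          (sumTuples-cong k λ T → *-distribˡ-sum c (λ p → f (p ∷ T)))

  sumTuples-comm-∑ : ∀ {m} k (G : List (Fin n) → Fin m → ℕ) →
                     sumTuples k (λ T → ∑[ h < m ] G T h) ≡ ∑[ h < m ] sumTuples k (λ T → G T h)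
  sumTuples-comm-∑ N.zero    G = refl
  sumTuples-comm-∑ (N.suc k) G =
    trans (sumTuples-cong k λ T → ∑-comm (λ p h → G (p ∷ T) h))
          (sumTuples-comm-∑ k λ T h → ∑[ p < n ] G (p ∷ T) h)

  sumTuples-all : ∀ {Q : Fin n → Set} (Q? : Decidable Q) k →
                  sumTuples k (λ T → indicator (All.all? Q? T)) ≡ (∑[ p < n ] indicator (Q? p)) ^ k
  sumTuples-all Q? N.zero    = refl
  sumTuples-all Q? (N.suc k) = begin
    sumTuples k (λ T → ∑[ p < n ] indicator (All.all? Q? (p ∷ T)))
      ≡⟨ sumTuples-cong k (λ T → sum-cong-≗ λ p →
           indicator-× All.uncons (λ q qs → q ∷ qs) (All.all? Q? (p ∷ T)) (Q? p) (All.all? Q? T)) ⟩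
    sumTuples k (λ T → ∑[ p < n ] (indicator (Q? p) * indicator (All.all? Q? T)))
      ≡⟨ sumTuples-cong k (λ T → *-distribʳ-sum (indicator (All.all? Q? T)) (λ p → indicator (Q? p))) ⟨
    sumTuples k (λ T → #Q * indicator (All.all? Q? T))
      ≡⟨ *-distribˡ-sumTuples k #Q _ ⟨
    #Q * sumTuples k (λ T → indicator (All.all? Q? T))
      ≡⟨ cong (#Q *_) (sumTuples-all Q? k) ⟩
    #Q * #Q ^ k ∎
    where
    open ≡-Reasoning
    #Q = ∑[ p < n ] indicator (Q? p)

  average-attained : Fin n → ∀ k (f : List (Fin n) → ℕ) → ∃ λ T → sumTuples k f ≤ n ^ k * f T
  average-attained p₀ N.zero    f = [] , ≤-reflexive (sym (*-identityˡ (f [])))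
  average-attained p₀ (N.suc k) f = best T ∷ T , (begin
    sumTuples k (λ T → ∑[ p < n ] f (p ∷ T))  ≤⟨ sumTuples-mono-≤ k (λ T _ → proj₂ (sum≤max T)) ⟩
    sumTuples k (λ T → n * f (best T ∷ T))    ≡⟨ *-distribˡ-sumTuples k n _ ⟨
    n * sumTuples k (λ T → f (best T ∷ T))    ≤⟨ *-monoʳ-≤ n sum≤average ⟩
    n * (n ^ k * f (best T ∷ T))              ≡⟨ *-assoc n (n ^ k) _ ⟨
    n * n ^ k * f (best T ∷ T)                ∎)
    where
    open ≤-Reasoning
    sum≤max : ∀ T → ∃ λ p → ∑[ p′ < n ] f (p′ ∷ T) ≤ n * f (p ∷ T)
    sum≤max T = sum≤size*max p₀ λ p → f (p ∷ T)
    best : List (Fin n) → Fin n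
    best T = proj₁ (sum≤max T)
    T = proj₁ (average-attained p₀ k λ T → f (best T ∷ T))
    sum≤average = proj₂ (average-attained p₀ k λ T → f (best T ∷ T))

  exceeds-averages : Fin n → ∀ k (f : List (Fin n) → ℕ) → ∃ λ T → ∀ j → j ≤ k → sumTuples j f ≤ n ^ j * f T
  exceeds-averages p₀ N.zero    f = [] , below
    where
    below : ∀ j → j ≤ 0 → sumTuples j f ≤ n ^ j * f []
    below N.zero z≤n = ≤-reflexive (sym (*-identityˡ (f [])))
  exceeds-averages p₀ (N.suc k) f = proj₁ larger , below
    where
    T₁ = proj₁ (exceeds-averages p₀ k f)
    T₂ = proj₁ (average-attained p₀ (N.suc k) f)
    larger : ∃ λ T → f T₁ ≤ f T × f T₂ ≤ f T
    larger = [ (λ f₁≤f₂ → T₂ , f₁≤f₂ , ≤-refl) , (λ f₂≤f₁ → T₁ , ≤-refl , f₂≤f₁) ]′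
               (≤-total (f T₁) (f T₂))
    below : ∀ j → j ≤ N.suc k → sumTuples j f ≤ n ^ j * f (proj₁ larger)
    below j j≤1+k = [ (λ j<1+k → ≤-trans (proj₂ (exceeds-averages p₀ k f) j (N.s≤s⁻¹ j<1+k))
                                         (*-monoʳ-≤ (n ^ j) (proj₁ (proj₂ larger))))
                    , (λ j≡1+k → subst (λ j → sumTuples j f ≤ n ^ j * f (proj₁ larger)) (sym j≡1+k)
                         (≤-trans (proj₂ (average-attained p₀ (N.suc k) f))
                                  (*-monoʳ-≤ (n ^ N.suc k) (proj₂ (proj₂ larger))))) ]′
                    (m≤n⇒m<n∨m≡n j≤1+k)

module Homogenisation (F : CompleteOrderedField) where
  open CompleteOrderedField F
  open OrderedFieldProperties F
  open TriangularSystems F using (Nonzero)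

  lift : ∀ {d} → Point d → Vec Carrier (N.suc d)
  lift p = 1# ∷ p

  equation : ∀ {d} → Hyperplane d → Vec Carrier (N.suc d)
  equation h = - Hyperplane.offset h ∷ Hyperplane.normal h

  incident⇒dot≡0 : ∀ {d} {p : Point d} {h} → Incident p h → dot (equation h) (lift p) ≡ 0#
  incident⇒dot≡0 {h = h} p∈h = trans (cong₂ _+_ (*-identityʳ _) p∈h) (-‿inverseˡ (Hyperplane.offset h))

  ¬incident⇒dot≢0 : ∀ {d} {p : Point d} {h} → ¬ Incident p h → dot (equation h) (lift p) ≢ 0#
  ¬incident⇒dot≢0 {h = h} p∉h -b+ap≡0 = p∉h (begin
    dot (Hyperplane.normal h) _      ≡⟨ +-inverseʳ-unique _ _ -b+ap≡0 ⟩
    - (- Hyperplane.offset h * 1#)   ≡⟨ cong -_ (*-identityʳ _) ⟩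
    - - Hyperplane.offset h          ≡⟨ -‿involutive _ ⟩
    Hyperplane.offset h              ∎)
    where open ≡-Reasoning

  equation-nonzero : ∀ {d} (h : Hyperplane d) → Nonzero (equation h)
  equation-nonzero h (_ VAll.∷ a≡0) = Hyperplane.normal≢0 h a≡0

module IncidenceCounting (F : CompleteOrderedField) {d n′ m : ℕ}
  (P : Fin (N.suc n′) → CompleteOrderedField.Point F d)
  (H : Fin m → CompleteOrderedField.Hyperplane F d) where
  open CompleteOrderedField F using (dot; Incident; Hyperplane; CompleteBipartite)
  open DecidableEquality F using (_≟_)
  open TriangularSystems F
  open Homogenisation F
  open FinSums
  open TupleSums (N.suc n′)
  open import Data.Nat using (_+_; _*_; _^_; _≤_; z≤n)
  open import Data.Nat.Properties
    using ( ≤-refl; ≤-trans; ≤-reflexive; <-irrefl; m≤m+n; m≤n+m; m≤n⇒m≤1+n; +-mono-≤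
          ; *-identityʳ; *-zeroʳ; *-comm; *-monoʳ-≤; ^-monoˡ-≤; module ≤-Reasoning)
  open import Data.Nat.Tactic.RingSolver using (solve-∀)
  open import Data.List using (List; length; allFin; filter)
  open import Data.List.Properties using (filter-none)
  open import Data.List.Relation.Unary.All.Properties using (all-filter; ¬All⇒Any¬)
  open import Data.List.Relation.Unary.Unique.Propositional using (Unique)
  import Data.List.Relation.Unary.Unique.Propositional.Properties as Unique
  import Data.List.Relation.Unary.Any as Any

  private
    n : ℕ
    n = N.suc n′

  On : Fin n → Fin m → Set
  On p h = Incident (P p) (H h)

  opaque
    on? : ∀ p h → Dec (On p h)
    on? p h = dot (Hyperplane.normal (H h)) (P p) ≟ Hyperplane.offset (H h)

  Through : List (Fin n) → Fin m → Set
  Through T h = All (λ p → On p h) T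

  through? : ∀ T h → Dec (Through T h)
  through? T h = All.all? (λ p → on? p h) T

  hyperplanesThrough : List (Fin n) → List (Fin m)
  hyperplanesThrough T = filter (through? T) (allFin m)

  OnAll : List (Fin m) → Fin n → Set
  OnAll B p = All (On p) B

  onAll? : ∀ B p → Dec (OnAll B p)
  onAll? B p = All.all? (on? p) B

  closure : List (Fin n) → List (Fin n)
  closure T = filter (onAll? (hyperplanesThrough T)) (allFin n)

  richness : List (Fin n) → ℕ
  richness T = length (closure T) * length (hyperplanesThrough T)

  closure-completeBipartite : ∀ T → CompleteBipartite P H (closure T) (hyperplanesThrough T)
  closure-completeBipartite T = Unique.filter⁺ (onAll? (hyperplanesThrough T)) (Unique.allFin⁺ n) ,
                                Unique.filter⁺ (through? T) (Unique.allFin⁺ m) ,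
                                all-filter (onAll? (hyperplanesThrough T)) (allFin n)

  -- Tuples list their most recent point first. A point that already lies in the closure of the points
  -- before it is redundant, and is charged the number of hyperplanes through those points.
  redundancy : List (Fin n) → ℕ
  redundancy []      = 0
  redundancy (p ∷ T) = redundancy T + length (hyperplanesThrough T) * indicator (onAll? (hyperplanesThrough T) p)

  degree : Fin m → ℕ
  degree h = ∑[ p < n ] indicator (on? p h)

  length-hyperplanesThrough : ∀ T → length (hyperplanesThrough T) ≡ ∑[ h < m ] indicator (through? T h)
  length-hyperplanesThrough T = length-filter-tabulate (through? T) (λ h → h)

  length-closure : ∀ T → length (closure T) ≡ ∑[ p < n ] indicator (onAll? (hyperplanesThrough T) p)
  length-closure T = length-filter-tabulate (onAll? (hyperplanesThrough T)) (λ p → p)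

  hyperplanesThrough-anti : ∀ p T → length (hyperplanesThrough (p ∷ T)) ≤ length (hyperplanesThrough T)
  hyperplanesThrough-anti p T =
    subst₂ _≤_ (sym (length-hyperplanesThrough (p ∷ T))) (sym (length-hyperplanesThrough T))
      (sum-mono-≤ λ h → indicator-mono All.tail (through? (p ∷ T) h) (through? T h))

  escaping-hyperplane : ∀ p T → ¬ OnAll (hyperplanesThrough T) p → ∃ λ g → Through T g × ¬ On p g
  escaping-hyperplane p T p∉cl = Any.lookup escape , All.lookupAny (all-filter (through? T) (allFin m)) escape
    where
    escape = ¬All⇒Any¬ (on? p) (hyperplanesThrough T) p∉cl

  Independent : List (Fin n) → Set
  Independent T = ∃ λ xs → Triangular xs × length xs ≡ length T ×
                    (∀ h → Through T h → AnnihilatedBy (equation (H h)) xs)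

  -- Unless a redundant point occurs, each new point p leaves some hyperplane g through the earlier points,
  -- and (equation g, lift p) extends a triangular family of lifted points.
  redundant-or-independent : ∀ T → length (hyperplanesThrough T) ≤ redundancy T ⊎ Independent T
  redundant-or-independent []      = inj₂ ([] , _ , refl , λ _ _ → [])
  redundant-or-independent (p ∷ T) with redundant-or-independent T
  ... | inj₁ B≤R = inj₁ (≤-trans (hyperplanesThrough-anti p T) (≤-trans B≤R (m≤m+n _ _)))
  ... | inj₂ (xs , tri , |xs|≡|T| , annihilated) with onAll? (hyperplanesThrough T) p
  ...   | yes _   = inj₁ (≤-trans (hyperplanesThrough-anti p T)
                                  (≤-trans (≤-reflexive (sym (*-identityʳ _))) (m≤n+m _ _)))
  ...   | no p∉cl with escaping-hyperplane p T p∉cl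
  ...     | g , T⊆g , p∉g = inj₂ ((equation (H g) , lift (P p)) ∷ xs ,
                              (¬incident⇒dot≢0 {p = P p} {H g} p∉g , annihilated g T⊆g , tri) ,
                              cong N.suc |xs|≡|T| ,
                              λ { h (p∈h ∷ T⊆h) → incident⇒dot≡0 {p = P p} {H h} p∈h ∷ annihilated h T⊆h })

  hyperplanesThrough≤redundancy : ∀ T → length T ≡ N.suc d → length (hyperplanesThrough T) ≤ redundancy T
  hyperplanesThrough≤redundancy T |T|≡1+d with redundant-or-independent T
  ... | inj₁ B≤R = B≤R
  ... | inj₂ (xs , tri , |xs|≡|T| , annihilated) =
    subst (_≤ redundancy T) (cong length (sym (filter-none (through? T) (All.universal none (allFin m))))) z≤n
    where
    none : ∀ h → ¬ Through T h
    none h T⊆h = <-irrefl (trans |xs|≡|T| |T|≡1+d)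
      (annihilated-length< (equation-nonzero (H h)) xs (annihilated h T⊆h) tri)

  sumTuples-hyperplanesThrough : ∀ k → sumTuples k (λ T → length (hyperplanesThrough T)) ≡ ∑[ h < m ] (degree h ^ k)
  sumTuples-hyperplanesThrough k = begin
    sumTuples k (λ T → length (hyperplanesThrough T))
      ≡⟨ sumTuples-cong k length-hyperplanesThrough ⟩
    sumTuples k (λ T → ∑[ h < m ] indicator (through? T h))
      ≡⟨ sumTuples-comm-∑ k (λ T h → indicator (through? T h)) ⟩
    ∑[ h < m ] sumTuples k (λ T → indicator (through? T h))
      ≡⟨ sum-cong-≗ (λ h → sumTuples-all (λ p → on? p h) k) ⟩
    ∑[ h < m ] (degree h ^ k)
      ∎
    where open ≡-Reasoning

  sumTuples-redundancy-step : ∀ k →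
    sumTuples (N.suc k) redundancy ≡ n * sumTuples k redundancy + sumTuples k richness
  sumTuples-redundancy-step k =
    trans (sumTuples-cong k step) (trans (sumTuples-distrib-+ k (λ T → n * redundancy T) richness)
                                         (cong (_+ sumTuples k richness) (sym (*-distribˡ-sumTuples k n redundancy))))
    where
    open ≡-Reasoning
    step : ∀ T → ∑[ p < n ] redundancy (p ∷ T) ≡ n * redundancy T + richness T
    step T = begin
      ∑[ p < n ] (redundancy T + #B * indicator (onAll? B p))
        ≡⟨ ∑-distrib-+ (λ _ → redundancy T) (λ p → #B * indicator (onAll? B p)) ⟩
      ∑[ p < n ] redundancy T + ∑[ p < n ] (#B * indicator (onAll? B p))
        ≡⟨ cong₂ _+_ (sum-const n (redundancy T)) (sym (*-distribˡ-sum #B (λ p → indicator (onAll? B p)))) ⟩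
      n * redundancy T + #B * ∑[ p < n ] indicator (onAll? B p)
        ≡⟨ cong (λ t → n * redundancy T + #B * t) (length-closure T) ⟨
      n * redundancy T + #B * length (closure T)
        ≡⟨ cong (n * redundancy T +_) (*-comm #B (length (closure T))) ⟩
      n * redundancy T + richness T
        ∎
      where
      B = hyperplanesThrough T
      #B = length B

  sumTuples-redundancy≤ : ∀ k M → (∀ j → j ≤ k → sumTuples j richness ≤ n ^ j * M) →
                          sumTuples (N.suc k) redundancy ≤ N.suc k * n ^ k * M
  sumTuples-redundancy≤ N.zero    M richness≤ = begin
    sumTuples 1 redundancy           ≡⟨ sumTuples-redundancy-step 0 ⟩
    n * 0 + richness []              ≡⟨ cong (_+ richness []) (*-zeroʳ n) ⟩
    richness []                      ≤⟨ richness≤ 0 z≤n ⟩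
    1 * M                            ≡⟨ cong (_* M) (*-identityʳ 1) ⟨
    1 * 1 * M                        ∎
    where open ≤-Reasoning
  sumTuples-redundancy≤ (N.suc k) M richness≤ = begin
    sumTuples (2 + k) redundancy                                  ≡⟨ sumTuples-redundancy-step (N.suc k) ⟩
    n * sumTuples (1 + k) redundancy + sumTuples (1 + k) richness ≤⟨ +-mono-≤
      (*-monoʳ-≤ n (sumTuples-redundancy≤ k M λ j j≤k → richness≤ j (m≤n⇒m≤1+n j≤k)))
      (richness≤ (1 + k) ≤-refl) ⟩
    n * ((1 + k) * n ^ k * M) + n * n ^ k * M                      ≡⟨ distribute n k (n ^ k) M ⟩
    (2 + k) * (n * n ^ k) * M                                     ∎
    where
    open ≤-Reasoning
    distribute : ∀ n k p M → n * ((1 + k) * p * M) + n * p * M ≡ (2 + k) * (n * p) * M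
    distribute = solve-∀

  incidences≤∑degree : (L : List (Fin n × Fin m)) → Unique L → All (λ (p , h) → On p h) L →
                       length L ≤ ∑[ h < m ] degree h
  incidences≤∑degree L L-unique L-incident =
    subst (length L ≤_) (∑-comm λ p h → indicator (on? p h))
      (length-unique≤∑∑ L (λ p h → indicator (on? p h)) L-unique
        (All.map (λ { {p , h} p∈h → 1≤indicator p∈h (on? p h) }) L-incident))

  rich-tuple : (L : List (Fin n × Fin m)) → Unique L → All (λ (p , h) → On p h) L →
               ∃ λ T → length L ^ N.suc d ≤ (m * n) ^ d * (N.suc d * richness T)
  rich-tuple L L-unique L-incident = T , (begin
    length L ^ N.suc d
      ≤⟨ ^-monoˡ-≤ (N.suc d) (incidences≤∑degree L L-unique L-incident) ⟩
    (∑[ h < m ] degree h) ^ N.suc d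
      ≤⟨ power-mean d degree ⟩
    m ^ d * ∑[ h < m ] (degree h ^ N.suc d)
      ≡⟨ cong (m ^ d *_) (sumTuples-hyperplanesThrough (N.suc d)) ⟨
    m ^ d * sumTuples (N.suc d) (λ T → length (hyperplanesThrough T))
      ≤⟨ *-monoʳ-≤ (m ^ d) (sumTuples-mono-≤ (N.suc d) hyperplanesThrough≤redundancy) ⟩
    m ^ d * sumTuples (N.suc d) redundancy
      ≤⟨ *-monoʳ-≤ (m ^ d) (sumTuples-redundancy≤ d (richness T) T-rich) ⟩
    m ^ d * (N.suc d * n ^ d * richness T)
      ≡⟨ rearrange (m ^ d) (n ^ d) (N.suc d) (richness T) ⟩
    m ^ d * n ^ d * (N.suc d * richness T)
      ≡⟨ cong (_* (N.suc d * richness T)) ([m*n]^k≡m^k*n^k d) ⟨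
    (m * n) ^ d * (N.suc d * richness T)
      ∎)
    where
    open ≤-Reasoning
    T = proj₁ (exceeds-averages Fin.zero d richness)
    T-rich = proj₂ (exceeds-averages Fin.zero d richness)
    rearrange : ∀ a b s r → a * (s * b * r) ≡ a * b * (s * r)
    rearrange = solve-∀
    interchange : ∀ a b c e → a * b * (c * e) ≡ a * c * (b * e)
    interchange = solve-∀
    [m*n]^k≡m^k*n^k : ∀ k → (m * n) ^ k ≡ m ^ k * n ^ k
    [m*n]^k≡m^k*n^k N.zero    = refl
    [m*n]^k≡m^k*n^k (N.suc k) = trans (cong (m * n *_) ([m*n]^k≡m^k*n^k k)) (interchange m n (m ^ k) (n ^ k))

module RichBipartiteSubgraph (F : CompleteOrderedField) where
  open CompleteOrderedField F
  open OrderedFieldProperties F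

  rich-bipartite : (d : ℕ) → 1 N.≤ d → (ε : Carrier) → 0# < ε → ε ≤ 1# →
    (n m : ℕ) → (P : Fin n → Point d) → (H : Fin m → Hyperplane d) →
    DistinctPoints P → DistinctHyperplanes H →
    IncidencesAtLeast P H (ε * (fromℕ m * fromℕ n)) →
    fromℕ 2 < ε ^ d * fromℕ n →
    Σ (List (Fin n)) λ A → Σ (List (Fin m)) λ B → CompleteBipartite P H A B ×
      ε ^ (2 N.* d) * (fromℕ m * fromℕ n) ≤ fromℕ 2 * fromℕ d * (fromℕ (length A) * fromℕ (length B))
  rich-bipartite d 1≤d ε (0≤ε , _) ε≤1 N.zero      m P H _ _ _ (2≤ε^d*0 , _) =
    ⊥-elim (fromℕ-suc≰0 1 (subst (fromℕ 2 ≤_) (zeroʳ _) 2≤ε^d*0))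
  rich-bipartite d 1≤d ε (0≤ε , _) ε≤1 (N.suc n′) m P H _ _ (L , L-unique , L-incident , εc≤|L|) _ =
    closure T , hyperplanesThrough T , closure-completeBipartite T , (begin
      ε ^ (2 N.* d) * c
        ≤⟨ *-monoˡ-≤-nonNeg 0≤c (^-antimonoʳ-≤ 0≤ε ε≤1 1+d≤2*d) ⟩
      ε ^ N.suc d * c
        ≡⟨ cong (ε ^ N.suc d *_) (fromℕ-homo-* m n) ⟨
      ε ^ N.suc d * fromℕ (m N.* n)
        ≤⟨ ^-cancel-fromℕ d (m N.* n) (0≤fromℕ (N.suc d N.* r)) [εc]^[1+d]≤ ⟩
      fromℕ (N.suc d N.* r)
        ≤⟨ fromℕ-mono-≤ (ℕₚ.*-monoˡ-≤ r 1+d≤2*d) ⟩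
      fromℕ (2 N.* d N.* r)
        ≡⟨ trans (fromℕ-homo-* (2 N.* d) r) (cong₂ _*_ (fromℕ-homo-* 2 d) (fromℕ-homo-* a b)) ⟩
      fromℕ 2 * fromℕ d * (fromℕ a * fromℕ b)
        ∎)
    where
    open IncidenceCounting F P H
    open ≤-Reasoning
    n = N.suc n′
    c = fromℕ m * fromℕ n
    0≤c : 0# ≤ c
    0≤c = *-nonneg (0≤fromℕ m) (0≤fromℕ n)
    rich = rich-tuple L L-unique (All.map (λ { {p , h} p∈h → p∈h }) L-incident)
    T = proj₁ rich
    a = length (closure T)
    b = length (hyperplanesThrough T)
    r = richness T
    1+d≤2*d : N.suc d N.≤ 2 N.* d
    1+d≤2*d = subst (N.suc d N.≤_) (cong (d N.+_) (sym (ℕₚ.+-identityʳ d))) (ℕₚ.+-monoˡ-≤ d 1≤d)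
    [εc]^[1+d]≤ : (ε * fromℕ (m N.* n)) ^ N.suc d ≤ fromℕ (m N.* n) ^ d * fromℕ (N.suc d N.* r)
    [εc]^[1+d]≤ = begin
      (ε * fromℕ (m N.* n)) ^ N.suc d                ≡⟨ cong (λ t → (ε * t) ^ N.suc d) (fromℕ-homo-* m n) ⟩
      (ε * c) ^ N.suc d                              ≤⟨ ^-monoˡ-≤ (N.suc d) (*-nonneg 0≤ε 0≤c) εc≤|L| ⟩
      fromℕ (length L) ^ N.suc d                     ≡⟨ fromℕ-homo-^ (length L) (N.suc d) ⟨
      fromℕ (length L N.^ N.suc d)                   ≤⟨ fromℕ-mono-≤ (proj₂ rich) ⟩
      fromℕ ((m N.* n) N.^ d N.* (N.suc d N.* r))    ≡⟨ trans (fromℕ-homo-* ((m N.* n) N.^ d) (N.suc d N.* r))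
                                                               (cong (_* fromℕ (N.suc d N.* r)) (fromℕ-homo-^ (m N.* n) d)) ⟩
      fromℕ (m N.* n) ^ d * fromℕ (N.suc d N.* r)    ∎

theorem1p7 : Σ ℕ λ K → 1 N.≤ K ×
    ((F : CompleteOrderedField) → let open CompleteOrderedField F in
      (d : ℕ) → 1 N.≤ d → (ε : Carrier) → 0# < ε → ε ≤ 1# →
      (n m : ℕ) → (P : Fin n → Point d) → (H : Fin m → Hyperplane d) →
      DistinctPoints P → DistinctHyperplanes H →
      IncidencesAtLeast P H (ε * (fromℕ m * fromℕ n)) →
      fromℕ 2 < ε ^ d * fromℕ n →
      Σ (List (Fin n)) λ A → Σ (List (Fin m)) λ B → CompleteBipartite P H A B ×
        ε ^ (2 N.* d) * (fromℕ m * fromℕ n)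
          ≤ fromℕ K * fromℕ d * (fromℕ (length A) * fromℕ (length B)))
theorem1p7 = 2 , N.s≤s N.z≤n , RichBipartiteSubgraph.rich-bipartite
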